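{- Let $n$ be a positive integer. The map $T\mapsto\mathrm{str}(T)$ is a bijection from the set of packed RAT of diagonal type and size $(n,1)$ to the set of alternative tableaux of size $n$ with no free rows.
   Context: Rhombic diagrams. For a word $w=w_1\cdots w_n\in\{0,1,2\}^n$, the rhombic diagram $\Gamma_w$ is the region bounded by two lattice paths from a common starting point: the southeast border, obtained by reading $w$ left to right with a unit step south for each $2$, southwest (vector $(-1,-1)$) for each $1$, west for each $0$; and the northwest border, consisting of (number of $0$'s) steps west, then (number of $1$'s) steps southwest, then (number of $2$'s) steps south. It is tiled by unit squares, tall rhombi (two vertical and two diagonal sides) and short rhombi (two horizontal and two diagonal sides) via the maximal tiling: if no $i$ has $w_i>w_{i+1}$ nothing is tiled; otherwise take the smallest such $i$, tile the region of the word obtained by swapping $w_i,w_{i+1}$, and fill the remaining tile by a tall rhombus, square or short rhombus according as $(w_i,w_{i+1})=(2,1),(2,0),(1,0)$. Label the southeast border edges $1,\dots,n$ from northeast to southwest; each edge starts a strip (maximal sequence of tiles connected through parallel edges, possibly empty) carrying its label; strips from vertical edges are rows, from horizontal edges columns, from diagonal edges diagonal strips. For $i<j$ the cell $(i,j)$ is the tile in strips $i$ and $j$ if it exists: a square if $(w_i,w_j)=(2,0)$, a tall rhombus if $(2,1)$, a short rhombus if $(1,0)$. A RAT is a filling of some tiles with up-arrows (only in tiles of a column) and left-arrows (only in tiles of a row) such that no arrow lies in a cell pointed to by another arrow, where a left-arrow points to all other cells of its row to its west and an up-arrow to all other cells of its column to its north. A RAT has size $(n,r)$ if its shape has length $n$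 with $r$ letters $1$. An alternative tableau of size $n$ is a RAT of size $(n,0)$ (its tiles are all squares); a free row is a row with no left-arrow. A RAT of size $(n,1)$ with exactly $n-1$ arrows is called a packed RAT of diagonal type. The map $\mathrm{str}$: let $T$ be a packed RAT of diagonal type, of shape $w$ with its unique letter $1$ at position $d$. Then $\mathrm{str}(T)$ is the alternative tableau of shape $w'$, obtained from $w$ by replacing $w_d=1$ by $0$, in which each square $(i,j)$ with $i,j\neq d$ has the same content as in $T$, each square $(i,d)$ (for $i<d$ with $w_i=2$) receives the content of the tall rhombus $(i,d)$ of $T$, and the short rhombi $(d,j)$ of $T$ together with their contents are deleted. -}

module Defs where

open import Data.Nat using (ℕ; zero; suc; _+_; _∸_)
import Data.Nat as ℕ
open import Data.Fin using (Fin; toℕ)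
import Data.Fin as F
open import Data.Vec using (Vec; lookup; map; sum)
open import Data.Product using (_×_; _,_; Σ; ∃)
open import Data.Sum using (_⊎_)
open import Relation.Binary.PropositionalEquality using (_≡_; _≢_)

data Letter : Set where
  l0 l1 l2 : Letter

val : Letter → ℕ
val l0 = 0
val l1 = 1
val l2 = 2

Word : ℕ → Set
Word n = Vec Letter n

data Content : Set where
  empty up left : Content

-- A filling: entry (i , j) is the content of the cell (i , j) (meaningful
-- only for cells; all other entries are required to be empty).
Filling : ℕ → Set
Filling n = Vec (Vec Content n) n

Tab : ℕ → Set
Tab n = Word n × Filling n

entry : ∀ {n} → Filling n → Fin n → Fin n → Content
entry F i j = lookup (lookup F i) j

-- Cell (i , j) exists (i < j) iff w_i > w_j (each inversion of w gets
-- exactly one tile of the maximal tiling, lying in strips i and j).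
IsCell : ∀ {n} → Word n → Fin n → Fin n → Set
IsCell w i j = (i F.< j) × (val (lookup w j) ℕ.< val (lookup w i))

-- Within column j (w_j = 0), cell (i' , j) lies to the north of cell (i , j).
-- The maximal tiling is built by insertion sort (smallest descent first), so
-- column j crosses the strips i < j with w_i > 0 in the following order from
-- south to north: the rows (w_i = 2) by decreasing i, then the diagonal
-- strips (w_i = 1) by decreasing i.
NorthOf : ∀ {n} → Word n → Fin n → Fin n → Set
NorthOf w i' i =
  ((lookup w i' ≡ lookup w i) × (i' F.< i))
  ⊎ ((lookup w i' ≡ l1) × (lookup w i ≡ l2))

-- Within row i (w_i = 2), cell (i , j') lies to the west of cell (i , j)
-- iff j < j' (row i is crossed by the strips j > i in increasing order).
PointsTo : ∀ {n} → Tab n → Fin n → Fin n → Fin n → Fin n → Set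
PointsTo (w , F) i j i' j' =
  ((entry F i j ≡ left) × (i' ≡ i) × (j F.< j'))
  ⊎ ((entry F i j ≡ up) × (j' ≡ j) × NorthOf w i' i)

IsRAT : ∀ {n} → Tab n → Set
IsRAT {n} (w , F) =
  (∀ i j → entry F i j ≡ up → IsCell w i j × (lookup w j ≡ l0))
  × (∀ i j → entry F i j ≡ left → IsCell w i j × (lookup w i ≡ l2))
  × (∀ i j i' j' → PointsTo (w , F) i j i' j' → entry F i' j' ≡ empty)

isOne : Letter → ℕ
isOne l1 = 1
isOne _  = 0

ones : ∀ {n} → Word n → ℕ
ones w = sum (map isOne w)

isArrow : Content → ℕ
isArrow empty = 0
isArrow _     = 1

arrows : ∀ {n} → Filling n → ℕ
arrows F = sum (map (λ row → sum (map isArrow row)) F)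

IsRATSize : (n r : ℕ) → Tab n → Set
IsRATSize n r T = IsRAT T × (ones (Data.Product.proj₁ T) ≡ r)

IsAltTableau : (n : ℕ) → Tab n → Set
IsAltTableau n T = IsRATSize n 0 T

NoFreeRows : ∀ {n} → Tab n → Set
NoFreeRows (w , F) = ∀ i → lookup w i ≡ l2 → ∃ λ j → entry F i j ≡ left

IsPackedDiag : (n : ℕ) → Tab n → Set
IsPackedDiag n T = IsRATSize n 1 T × (arrows (Data.Product.proj₂ T) ≡ n ∸ 1)

-- The (unique) letter 1 is replaced by 0; entries (i , j)
-- with i , j ≠ d are kept, entries (i , d) (tall rhombi, becoming squares)
-- are kept, and the row d (short rhombi (d , j)) is erased.
oneToZero : Letter → Letter
oneToZero l1 = l0
oneToZero x  = x

eraseIfOne : ∀ {n} → Letter → Vec Content n → Vec Content n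
eraseIfOne l1 row = map (λ _ → empty) row
eraseIfOne _  row = row

str : ∀ {n} → Tab n → Tab n
str (w , F) = map oneToZero w , Data.Vec.zipWith eraseIfOne w F

{-# OPTIONS --safe #-}
-- In a RAT every row holds at most one left arrow and every column at most one up arrow, so
-- #arrows + #1s ≤ n, with equality exactly when there is no free row and no free column.
-- Hence a packed RAT T of diagonal type is a RAT with a single letter 1 (at d, say) and no free
-- rows or columns.  Then str T has no free rows, and d is its least free column: a column j < d
-- keeps its up arrow, which lies in a row i < j.  The up arrows of the erased strip d sit exactly
-- in the columns j > d that str makes free, so T is recovered from str T.  Conversely, an
-- alternative tableau S without free rows has a free column (if its first letter is 2, the column
-- of the left arrow of row 1; otherwise column 1 itself); turning its least free column d into a
-- diagonal strip with up arrows in the free columns j > d gives a packed preimage of S.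
module Submission where

open import Defs
open import Data.Nat using (ℕ; zero; suc; _+_; _∸_; _≤_; _<_; z≤n; s≤s; z<s)
open import Data.Nat.Properties
  using ( ≤-refl; ≤-reflexive; ≤-trans; ≤-antisym; ≤-<-trans; <-irrefl; <-trans; n≮0; ≮⇒≥; n≤0⇒n≡0
        ; m≤m+n; m≤n+m; +-comm; +-mono-≤; +-monoˡ-≤; +-monoʳ-≤; +-identityʳ; +-cancelʳ-≤; +-cancelˡ-≡
        ; m+n∸n≡m; m∸n+n≡m; +-0-commutativeMonoid; module ≤-Reasoning)
open import Algebra.Properties.CommutativeMonoid.Sum +-0-commutativeMonoid
  using (sum; sum-syntax; sum-cong-≗; sum-replicate-zero; ∑-distrib-+; ∑-comm)
open import Data.Fin as Fin using (Fin; zero; suc; inject; fromℕ<)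
open import Data.Fin.Properties
  using (_≟_; <-cmp; <⇒≢; _<?_; all?; ¬∀⟶∃¬; ¬∀⟶∃¬-smallest; suc-injective; toℕ-injective; toℕ-inject; toℕ-fromℕ<)
open import Data.Vec as Vec using (Vec; []; _∷_; lookup; map; zipWith; tabulate; _[_]≔_)
open import Data.Vec.Properties
  using (tabulate∘lookup; tabulate-cong; lookup∘tabulate; lookup-map; lookup-zipWith; lookup∘update; lookup∘update′)
open import Data.Product using (_×_; _,_; ∃; proj₁; proj₂)
import Data.Product as Product
open import Data.Sum using (_⊎_; inj₁; inj₂)
open import Relation.Nullary using (¬_; Dec; yes; no; contradiction)
open import Relation.Nullary.Decidable using (_×-dec_; ¬?; decidable-stable)
open import Relation.Unary using (Decidable)
open import Relation.Binary using (tri<; tri≈; tri>)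
open import Relation.Binary.PropositionalEquality
  using (_≡_; _≢_; refl; sym; trans; cong; cong₂; subst; subst₂; module ≡-Reasoning)
open import Function using (_∘_)

∑-zero : ∀ {n} (f : Fin n → ℕ) → (∀ i → f i ≡ 0) → sum f ≡ 0
∑-zero {n} f f≡0 = trans (sum-cong-≗ f≡0) (sum-replicate-zero n)

∑-ones : ∀ n → ∑[ i < n ] 1 ≡ n
∑-ones zero    = refl
∑-ones (suc n) = cong suc (∑-ones n)

∑-mono-≤ : ∀ {n} {f g : Fin n → ℕ} → (∀ i → f i ≤ g i) → sum f ≤ sum g
∑-mono-≤ {zero}  f≤g = z≤n
∑-mono-≤ {suc n} f≤g = +-mono-≤ (f≤g zero) (∑-mono-≤ (f≤g ∘ suc))

term≤∑ : ∀ {n} (f : Fin n → ℕ) i → f i ≤ sum f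
term≤∑ f zero    = m≤m+n _ _
term≤∑ f (suc i) = ≤-trans (term≤∑ (f ∘ suc) i) (m≤n+m _ _)

two-terms≤∑ : ∀ {n} (f : Fin n → ℕ) {i j} → i ≢ j → f i + f j ≤ sum f
two-terms≤∑ f {zero}  {zero}  i≢j = contradiction refl i≢j
two-terms≤∑ f {zero}  {suc j} _   = +-monoʳ-≤ (f zero) (term≤∑ (f ∘ suc) j)
two-terms≤∑ f {suc i} {zero}  _   =
  ≤-trans (≤-reflexive (+-comm (f (suc i)) (f zero))) (+-monoʳ-≤ (f zero) (term≤∑ (f ∘ suc) i))
two-terms≤∑ f {suc i} {suc j} i≢j = ≤-trans (two-terms≤∑ (f ∘ suc) (i≢j ∘ cong suc)) (m≤n+m _ _)

∑-positive : ∀ {n} (f : Fin n → ℕ) → 0 < sum f → ∃ λ i → 0 < f i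
∑-positive {suc n} f 0<∑ with f zero in eq
... | suc _ = zero , subst (0 <_) (sym eq) z<s
... | zero  = let i , 0<fi = ∑-positive (f ∘ suc) 0<∑ in suc i , 0<fi

∑-≤-at-most-one : ∀ {n b} (f : Fin n → ℕ) → (∀ i → f i ≤ b) →
                  (∀ i j → 0 < f i → 0 < f j → i ≡ j) → sum f ≤ b
∑-≤-at-most-one {zero}  f f≤b unique = z≤n
∑-≤-at-most-one {suc n} {b} f f≤b unique with f zero in eq
... | zero  = ∑-≤-at-most-one (f ∘ suc) (f≤b ∘ suc) (λ i j p q → suc-injective (unique (suc i) (suc j) p q))
... | suc k = begin
  suc k + sum (f ∘ suc) ≡⟨ cong (suc k +_) (∑-zero (f ∘ suc) rest≡0) ⟩
  suc k + 0             ≡⟨ +-identityʳ (suc k) ⟩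
  suc k                 ≡⟨ eq ⟨
  f zero                ≤⟨ f≤b zero ⟩
  b                     ∎
  where
  open ≤-Reasoning
  rest≡0 : ∀ i → f (suc i) ≡ 0
  rest≡0 i = n≤0⇒n≡0 (≮⇒≥ λ 0<fi → contradiction (unique zero (suc i) (subst (0 <_) (sym eq) z<s) 0<fi) λ ())

∑-≤-pointwise-≡ : ∀ {n} {f g : Fin n → ℕ} → (∀ i → f i ≤ g i) → sum f ≡ sum g → ∀ i → f i ≡ g i
∑-≤-pointwise-≡ {suc n} {f} {g} f≤g ∑f≡∑g = λ { zero → head≡ ; (suc i) → ∑-≤-pointwise-≡ (f≤g ∘ suc) tail≡ i }
  where
  head≡ : f zero ≡ g zero
  head≡ = ≤-antisym (f≤g zero)
    (+-cancelʳ-≤ (sum (f ∘ suc)) (g zero) (f zero)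
      (≤-trans (+-monoʳ-≤ (g zero) (∑-mono-≤ (f≤g ∘ suc))) (≤-reflexive (sym ∑f≡∑g))))
  tail≡ : sum (f ∘ suc) ≡ sum (g ∘ suc)
  tail≡ = +-cancelˡ-≡ (g zero) _ _ (trans (cong (_+ sum (f ∘ suc)) (sym head≡)) ∑f≡∑g)

sum-map-lookup : ∀ {A : Set} {n} (g : A → ℕ) (v : Vec A n) → Vec.sum (map g v) ≡ ∑[ i < n ] g (lookup v i)
sum-map-lookup g []      = refl
sum-map-lookup g (x ∷ v) = cong (g x +_) (sum-map-lookup g v)

lookup-extensionality : ∀ {A : Set} {n} {xs ys : Vec A n} → (∀ i → lookup xs i ≡ lookup ys i) → xs ≡ ys
lookup-extensionality {xs = xs} {ys} xs≗ys =
  trans (sym (tabulate∘lookup xs)) (trans (tabulate-cong xs≗ys) (tabulate∘lookup ys))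

update-≡ : ∀ {A : Set} {n} {xs ys : Vec A n} {d x} →
           x ≡ lookup ys d → (∀ i → i ≢ d → lookup xs i ≡ lookup ys i) → xs [ d ]≔ x ≡ ys
update-≡ {xs = xs} {ys} {d} {x} x≡ ≢d⇒≡ = lookup-extensionality λ i → lookup-update i
  where
  lookup-update : ∀ i → lookup (xs [ d ]≔ x) i ≡ lookup ys i
  lookup-update i with i ≟ d
  ... | yes refl = trans (lookup∘update d xs x) x≡
  ... | no i≢d   = trans (lookup∘update′ i≢d xs x) (≢d⇒≡ i i≢d)

Least : ∀ {n} → (Fin n → Set) → Fin n → Set
Least P i = P i × (∀ j → j Fin.< i → ¬ P j)

least-unique : ∀ {n} {P : Fin n → Set} {i i′} → Least P i → Least P i′ → i ≡ i′
least-unique {i = i} {i′} (Pi , least) (Pi′ , least′) with <-cmp i i′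
... | tri< i<i′ _ _ = contradiction Pi (least′ i i<i′)
... | tri≈ _ i≡i′ _ = i≡i′
... | tri> _ _ i′<i = contradiction Pi′ (least i′ i′<i)

∃-least : ∀ {n} {P : Fin n → Set} → Decidable P → ∃ P → ∃ (Least P)
∃-least {n} {P} P? (i , Pi) with ¬∀⟶∃¬-smallest n (¬_ ∘ P) (¬? ∘ P?) (λ ∀¬P → ∀¬P i Pi)
... | k , ¬¬Pk , below =
  k , decidable-stable (P? k) ¬¬Pk , λ j j<k Pj → below (fromℕ< j<k) (subst P (sym (inject-fromℕ< j<k)) Pj)
  where
  inject-fromℕ< : ∀ {j k : Fin n} (j<k : j Fin.< k) → inject (fromℕ< j<k) ≡ j
  inject-fromℕ< j<k = toℕ-injective (trans (toℕ-inject (fromℕ< j<k)) (toℕ-fromℕ< j<k))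

l0? : (x : Letter) → Dec (x ≡ l0)
l0? l0 = yes refl
l0? l1 = no λ ()
l0? l2 = no λ ()

up? : (c : Content) → Dec (c ≡ up)
up? empty = no λ ()
up? up    = yes refl
up? left  = no λ ()

up≢empty : up ≢ empty
up≢empty ()

left≢empty : left ≢ empty
left≢empty ()

≢l0,l1⇒≡l2 : ∀ {x} → x ≢ l0 → x ≢ l1 → x ≡ l2
≢l0,l1⇒≡l2 {l0} ≢l0 _ = contradiction refl ≢l0
≢l0,l1⇒≡l2 {l1} _ ≢l1 = contradiction refl ≢l1
≢l0,l1⇒≡l2 {l2} _ _   = refl

<l2,≢l1⇒≡l0 : ∀ {x} → val x < val l2 → x ≢ l1 → x ≡ l0
<l2,≢l1⇒≡l0 {l0} _ _   = refl
<l2,≢l1⇒≡l0 {l1} _ ≢l1 = contradiction refl ≢l1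
<l2,≢l1⇒≡l0 {l2} (s≤s (s≤s ())) _

isCell : ∀ {n} (w : Word n) {i j x y} → i Fin.< j → lookup w i ≡ x → lookup w j ≡ y → val y < val x → IsCell w i j
isCell w i<j refl refl y<x = i<j , y<x

cell-row≢l0 : ∀ {n} (w : Word n) {i j} → IsCell w i j → lookup w i ≢ l0
cell-row≢l0 w {j = j} (_ , wj<wi) wi≡l0 = n≮0 (subst (λ x → val (lookup w j) < val x) wi≡l0 wj<wi)

northOf-cong : ∀ {n} (w w′ : Word n) {i i′} → lookup w i ≡ lookup w′ i → lookup w i′ ≡ lookup w′ i′ →
               NorthOf w i′ i → NorthOf w′ i′ i
northOf-cong _ _ wi≡ wi′≡ (inj₁ (same , i′<i)) = inj₁ (trans (sym wi′≡) (trans same wi≡) , i′<i)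
northOf-cong _ _ wi≡ wi′≡ (inj₂ (wi′≡l1 , wi≡l2)) = inj₂ (trans (sym wi′≡) wi′≡l1 , trans (sym wi≡) wi≡l2)

nonzero-letters : ∀ {x y} → x ≢ l0 → y ≢ l0 → x ≡ y ⊎ (x ≡ l1 × y ≡ l2) ⊎ (x ≡ l2 × y ≡ l1)
nonzero-letters {l0} {_}  x≢l0 _ = contradiction refl x≢l0
nonzero-letters {_}  {l0} _ y≢l0 = contradiction refl y≢l0
nonzero-letters {l1} {l1} _ _    = inj₁ refl
nonzero-letters {l2} {l2} _ _    = inj₁ refl
nonzero-letters {l1} {l2} _ _    = inj₂ (inj₁ (refl , refl))
nonzero-letters {l2} {l1} _ _    = inj₂ (inj₂ (refl , refl))

northOf-total : ∀ {n} (w : Word n) {i i′} → lookup w i ≢ l0 → lookup w i′ ≢ l0 → i ≢ i′ →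
                NorthOf w i′ i ⊎ NorthOf w i i′
northOf-total w {i} {i′} wi≢l0 wi′≢l0 i≢i′ with nonzero-letters wi≢l0 wi′≢l0
... | inj₂ (inj₁ (wi≡l1 , wi′≡l2)) = inj₂ (inj₂ (wi≡l1 , wi′≡l2))
... | inj₂ (inj₂ (wi≡l2 , wi′≡l1)) = inj₁ (inj₂ (wi′≡l1 , wi≡l2))
... | inj₁ wi≡wi′ with <-cmp i i′
...   | tri< i<i′ _ _ = inj₂ (inj₁ (wi≡wi′ , i<i′))
...   | tri≈ _ i≡i′ _ = contradiction i≡i′ i≢i′
...   | tri> _ _ i′<i = inj₁ (inj₁ (sym wi≡wi′ , i′<i))

isLeft : Content → ℕ
isLeft left = 1
isLeft _    = 0

isUp : Content → ℕ
isUp up = 1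
isUp _  = 0

isTwo : Letter → ℕ
isTwo l2 = 1
isTwo _  = 0

isZero : Letter → ℕ
isZero l0 = 1
isZero _  = 0

isLeft-positive : ∀ {c} → 0 < isLeft c → c ≡ left
isLeft-positive {left} _ = refl

isUp-positive : ∀ {c} → 0 < isUp c → c ≡ up
isUp-positive {up} _ = refl

isArrow≡isLeft+isUp : ∀ c → isArrow c ≡ isLeft c + isUp c
isArrow≡isLeft+isUp empty = refl
isArrow≡isLeft+isUp up    = refl
isArrow≡isLeft+isUp left  = refl

isTwo+isZero+isOne≡1 : ∀ x → isTwo x + isZero x + isOne x ≡ 1
isTwo+isZero+isOne≡1 l0 = refl
isTwo+isZero+isOne≡1 l1 = refl
isTwo+isZero+isOne≡1 l2 = refl

leftCount : ∀ {n} → Filling n → Fin n → ℕ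
leftCount {n} F i = ∑[ j < n ] isLeft (entry F i j)

upCount : ∀ {n} → Filling n → Fin n → ℕ
upCount {n} F j = ∑[ i < n ] isUp (entry F i j)

occupancy : ∀ {n} → Tab n → Fin n → ℕ
occupancy (w , F) k = leftCount F k + upCount F k + isOne (lookup w k)

arrows≡∑leftCount+upCount : ∀ {n} (F : Filling n) → arrows F ≡ ∑[ k < n ] (leftCount F k + upCount F k)
arrows≡∑leftCount+upCount {n} F = begin
  arrows F
    ≡⟨ sum-map-lookup _ F ⟩
  ∑[ i < n ] Vec.sum (map isArrow (lookup F i))
    ≡⟨ sum-cong-≗ (λ i → sum-map-lookup isArrow (lookup F i)) ⟩
  ∑[ i < n ] ∑[ j < n ] isArrow (entry F i j)
    ≡⟨ sum-cong-≗ (λ i → sum-cong-≗ (λ j → isArrow≡isLeft+isUp (entry F i j))) ⟩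
  ∑[ i < n ] ∑[ j < n ] (isLeft (entry F i j) + isUp (entry F i j))
    ≡⟨ sum-cong-≗ (λ i → ∑-distrib-+ (λ j → isLeft (entry F i j)) (λ j → isUp (entry F i j))) ⟩
  ∑[ i < n ] (leftCount F i + ∑[ j < n ] isUp (entry F i j))
    ≡⟨ ∑-distrib-+ (leftCount F) (λ i → ∑[ j < n ] isUp (entry F i j)) ⟩
  ∑[ i < n ] leftCount F i + ∑[ i < n ] ∑[ j < n ] isUp (entry F i j)
    ≡⟨ cong (∑[ i < n ] leftCount F i +_) (∑-comm (λ i j → isUp (entry F i j))) ⟩
  ∑[ i < n ] leftCount F i + ∑[ j < n ] upCount F j
    ≡⟨ ∑-distrib-+ (leftCount F) (upCount F) ⟨
  ∑[ k < n ] (leftCount F k + upCount F k) ∎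
  where open ≡-Reasoning

arrows+ones≡∑occupancy : ∀ {n} (w : Word n) (F : Filling n) → arrows F + ones w ≡ ∑[ k < n ] occupancy (w , F) k
arrows+ones≡∑occupancy w F =
  trans (cong₂ _+_ (arrows≡∑leftCount+upCount F) (sum-map-lookup isOne w))
        (sym (∑-distrib-+ (λ k → leftCount F k + upCount F k) (λ k → isOne (lookup w k))))

NoFreeColumns : ∀ {n} → Tab n → Set
NoFreeColumns (w , F) = ∀ j → lookup w j ≡ l0 → ∃ λ i → entry F i j ≡ up

module RAT {n} (w : Word n) (F : Filling n) (rat : IsRAT (w , F)) where

  up-in-column : ∀ {i j} → entry F i j ≡ up → IsCell w i j × lookup w j ≡ l0
  up-in-column = proj₁ rat _ _

  left-in-row : ∀ {i j} → entry F i j ≡ left → IsCell w i j × lookup w i ≡ l2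
  left-in-row = proj₁ (proj₂ rat) _ _

  pointed-empty : ∀ {i j i′ j′} → PointsTo (w , F) i j i′ j′ → entry F i′ j′ ≡ empty
  pointed-empty = proj₂ (proj₂ rat) _ _ _ _

  up-row≢l0 : ∀ {i j} → entry F i j ≡ up → lookup w i ≢ l0
  up-row≢l0 e = cell-row≢l0 w (proj₁ (up-in-column e))

  up-row : ∀ {i j} → entry F i j ≡ up → lookup w i ≢ l1 → lookup w i ≡ l2
  up-row e = ≢l0,l1⇒≡l2 (up-row≢l0 e)

  l0-row-empty : ∀ {i j} → lookup w i ≡ l0 → entry F i j ≡ empty
  l0-row-empty {i} {j} wi≡l0 with entry F i j in e
  ... | empty = refl
  ... | up    = contradiction wi≡l0 (up-row≢l0 e)
  ... | left  = contradiction (trans (sym wi≡l0) (proj₂ (left-in-row e))) λ ()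

  left-unique : ∀ {i j j′} → entry F i j ≡ left → entry F i j′ ≡ left → j ≡ j′
  left-unique {i} {j} {j′} e e′ with <-cmp j j′
  ... | tri< j<j′ _ _ = contradiction (trans (sym e′) (pointed-empty (inj₁ (e , refl , j<j′)))) left≢empty
  ... | tri≈ _ j≡j′ _ = j≡j′
  ... | tri> _ _ j′<j = contradiction (trans (sym e) (pointed-empty (inj₁ (e′ , refl , j′<j)))) left≢empty

  up-unique : ∀ {i i′ j} → entry F i j ≡ up → entry F i′ j ≡ up → i ≡ i′
  up-unique {i} {i′} e e′ with i ≟ i′
  ... | yes i≡i′ = i≡i′
  ... | no i≢i′ with northOf-total w (up-row≢l0 e) (up-row≢l0 e′) i≢i′
  ...   | inj₁ i′-north = contradiction (trans (sym e′) (pointed-empty (inj₂ (e , refl , i′-north)))) up≢empty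
  ...   | inj₂ i-north  = contradiction (trans (sym e) (pointed-empty (inj₂ (e′ , refl , i-north)))) up≢empty

  leftCount≤isTwo : ∀ i → leftCount F i ≤ isTwo (lookup w i)
  leftCount≤isTwo i = ∑-≤-at-most-one _ isLeft≤isTwo λ _ _ p q → left-unique (isLeft-positive p) (isLeft-positive q)
    where
    isLeft≤isTwo : ∀ j → isLeft (entry F i j) ≤ isTwo (lookup w i)
    isLeft≤isTwo j with entry F i j in e
    ... | left  = ≤-reflexive (cong isTwo (sym (proj₂ (left-in-row e))))
    ... | up    = z≤n
    ... | empty = z≤n

  upCount≤isZero : ∀ j → upCount F j ≤ isZero (lookup w j)
  upCount≤isZero j = ∑-≤-at-most-one _ isUp≤isZero λ _ _ p q → up-unique (isUp-positive p) (isUp-positive q)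
    where
    isUp≤isZero : ∀ i → isUp (entry F i j) ≤ isZero (lookup w j)
    isUp≤isZero i with entry F i j in e
    ... | up    = ≤-reflexive (cong isZero (sym (proj₂ (up-in-column e))))
    ... | left  = z≤n
    ... | empty = z≤n

  occupancy≤1 : ∀ k → occupancy (w , F) k ≤ 1
  occupancy≤1 k = ≤-trans (+-monoˡ-≤ (isOne (lookup w k)) (+-mono-≤ (leftCount≤isTwo k) (upCount≤isZero k)))
                          (≤-reflexive (isTwo+isZero+isOne≡1 (lookup w k)))

  full-row : ∀ {k} → occupancy (w , F) k ≡ 1 → lookup w k ≡ l2 → ∃ λ j → entry F k j ≡ left
  full-row {k} full wk≡l2 = Product.map₂ isLeft-positive (∑-positive _ (begin-strict
    0                                                         <⟨ z<s ⟩
    1                                                         ≡⟨ full ⟨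
    occupancy (w , F) k
      ≤⟨ +-monoˡ-≤ (isOne (lookup w k)) (+-monoʳ-≤ (leftCount F k) (upCount≤isZero k)) ⟩
    leftCount F k + isZero (lookup w k) + isOne (lookup w k)  ≡⟨ cong (λ x → leftCount F k + isZero x + isOne x) wk≡l2 ⟩
    leftCount F k + 0 + 0                                     ≡⟨ trans (+-identityʳ _) (+-identityʳ _) ⟩
    leftCount F k                                             ∎))
    where open ≤-Reasoning

  full-column : ∀ {k} → occupancy (w , F) k ≡ 1 → lookup w k ≡ l0 → ∃ λ i → entry F i k ≡ up
  full-column {k} full wk≡l0 = Product.map₂ isUp-positive (∑-positive _ (begin-strict
    0                                                       <⟨ z<s ⟩
    1                                                       ≡⟨ full ⟨
    occupancy (w , F) k
      ≤⟨ +-monoˡ-≤ (isOne (lookup w k)) (+-monoˡ-≤ (upCount F k) (leftCount≤isTwo k)) ⟩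
    isTwo (lookup w k) + upCount F k + isOne (lookup w k)   ≡⟨ cong (λ x → isTwo x + upCount F k + isOne x) wk≡l0 ⟩
    upCount F k + 0                                         ≡⟨ +-identityʳ _ ⟩
    upCount F k                                             ∎))
    where open ≤-Reasoning

  occupancy≥1 : NoFreeRows (w , F) → NoFreeColumns (w , F) → ∀ k → 1 ≤ occupancy (w , F) k
  occupancy≥1 noFreeRows noFreeColumns k with lookup w k in eq
  ... | l1 = m≤n+m 1 _
  ... | l2 = let j , e = noFreeRows k eq in begin
    1                               ≡⟨ cong isLeft e ⟨
    isLeft (entry F k j)            ≤⟨ term≤∑ (λ j → isLeft (entry F k j)) j ⟩
    leftCount F k                   ≤⟨ m≤m+n (leftCount F k) (upCount F k) ⟩
    leftCount F k + upCount F k     ≤⟨ m≤m+n _ 0 ⟩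
    leftCount F k + upCount F k + 0 ∎
    where open ≤-Reasoning
  ... | l0 = let i , e = noFreeColumns k eq in begin
    1                               ≡⟨ cong isUp e ⟨
    isUp (entry F i k)              ≤⟨ term≤∑ (λ i → isUp (entry F i k)) i ⟩
    upCount F k                     ≤⟨ m≤n+m (upCount F k) (leftCount F k) ⟩
    leftCount F k + upCount F k     ≤⟨ m≤m+n _ 0 ⟩
    leftCount F k + upCount F k + 0 ∎
    where open ≤-Reasoning

  arrows+ones≡n⇒noFreeLines : arrows F + ones w ≡ n → NoFreeRows (w , F) × NoFreeColumns (w , F)
  arrows+ones≡n⇒noFreeLines total = (λ i → full-row (full i)) , (λ j → full-column (full j))
    where
    full : ∀ k → occupancy (w , F) k ≡ 1
    full = ∑-≤-pointwise-≡ occupancy≤1 (trans (sym (arrows+ones≡∑occupancy w F)) (trans total (sym (∑-ones n))))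

  noFreeLines⇒arrows+ones≡n : NoFreeRows (w , F) → NoFreeColumns (w , F) → arrows F + ones w ≡ n
  noFreeLines⇒arrows+ones≡n noFreeRows noFreeColumns = begin
    arrows F + ones w                ≡⟨ arrows+ones≡∑occupancy w F ⟩
    ∑[ k < n ] occupancy (w , F) k   ≡⟨ sum-cong-≗ full ⟩
    ∑[ k < n ] 1                     ≡⟨ ∑-ones n ⟩
    n                                ∎
    where
    open ≡-Reasoning
    full : ∀ k → occupancy (w , F) k ≡ 1
    full k = ≤-antisym (occupancy≤1 k) (occupancy≥1 noFreeRows noFreeColumns k)

isOne-positive : ∀ {x} → 0 < isOne x → x ≡ l1
isOne-positive {l1} _ = refl

isOne≤1 : ∀ x → isOne x ≤ 1
isOne≤1 l0 = z≤n
isOne≤1 l1 = ≤-refl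
isOne≤1 l2 = z≤n

isOne≤ones : ∀ {n} (w : Word n) i → isOne (lookup w i) ≤ ones w
isOne≤ones w i = ≤-trans (term≤∑ (λ i → isOne (lookup w i)) i) (≤-reflexive (sym (sum-map-lookup isOne w)))

ones≡0⇒noOne : ∀ {n} (w : Word n) → ones w ≡ 0 → ∀ i → lookup w i ≢ l1
ones≡0⇒noOne w ones≡0 i wi≡l1 = n≮0 (subst₂ _≤_ (cong isOne wi≡l1) ones≡0 (isOne≤ones w i))

UniqueOneAt : ∀ {n} → Word n → Fin n → Set
UniqueOneAt w d = lookup w d ≡ l1 × (∀ i → lookup w i ≡ l1 → i ≡ d)

ones≡1⇒uniqueOne : ∀ {n} (w : Word n) → ones w ≡ 1 → ∃ (UniqueOneAt w)
ones≡1⇒uniqueOne {n} w ones≡1 with ∑-positive (λ i → isOne (lookup w i)) (subst (0 <_) ones≡∑ z<s)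
  where
  ones≡∑ : 1 ≡ ∑[ i < n ] isOne (lookup w i)
  ones≡∑ = trans (sym ones≡1) (sum-map-lookup isOne w)
... | d , 0<isOne = d , wd≡l1 , unique
  where
  wd≡l1 : lookup w d ≡ l1
  wd≡l1 = isOne-positive 0<isOne
  unique : ∀ i → lookup w i ≡ l1 → i ≡ d
  unique i wi≡l1 with i ≟ d
  ... | yes i≡d = i≡d
  ... | no i≢d  = contradiction (begin
    2                                         ≡⟨ cong₂ (λ x y → isOne x + isOne y) wi≡l1 wd≡l1 ⟨
    isOne (lookup w i) + isOne (lookup w d)   ≤⟨ two-terms≤∑ (λ i → isOne (lookup w i)) i≢d ⟩
    ∑[ i < n ] isOne (lookup w i)             ≡⟨ sum-map-lookup isOne w ⟨
    ones w                                    ≡⟨ ones≡1 ⟩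
    1                                         ∎) (<-irrefl refl)
    where open ≤-Reasoning

uniqueOne⇒ones≡1 : ∀ {n} (w : Word n) {d} → UniqueOneAt w d → ones w ≡ 1
uniqueOne⇒ones≡1 w {d} (wd≡l1 , unique) =
  ≤-antisym ones≤1 (≤-trans (≤-reflexive (cong isOne (sym wd≡l1))) (isOne≤ones w d))
  where
  ones≤1 : ones w ≤ 1
  ones≤1 = ≤-trans (≤-reflexive (sum-map-lookup isOne w))
                   (∑-≤-at-most-one _ (λ i → isOne≤1 (lookup w i))
                                      (λ i j p q → trans (unique i (isOne-positive p)) (sym (unique j (isOne-positive q)))))

packed⇒noFreeLines : ∀ {n} (T : Tab n) → 1 ≤ n → IsPackedDiag n T → NoFreeRows T × NoFreeColumns T
packed⇒noFreeLines {n} (w , F) 1≤n ((rat , ones≡1) , arrows≡n∸1) =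
  RAT.arrows+ones≡n⇒noFreeLines w F rat (trans (cong₂ _+_ arrows≡n∸1 ones≡1) (m∸n+n≡m 1≤n))

noFreeLines⇒packed : ∀ {n} (T : Tab n) → IsRAT T → ones (proj₁ T) ≡ 1 → NoFreeRows T → NoFreeColumns T → IsPackedDiag n T
noFreeLines⇒packed {n} (w , F) rat ones≡1 noFreeRows noFreeColumns = (rat , ones≡1) , (begin
  arrows F              ≡⟨ m+n∸n≡m (arrows F) 1 ⟨
  arrows F + 1 ∸ 1      ≡⟨ cong (λ k → arrows F + k ∸ 1) ones≡1 ⟨
  arrows F + ones w ∸ 1 ≡⟨ cong (_∸ 1) (RAT.noFreeLines⇒arrows+ones≡n w F rat noFreeRows noFreeColumns) ⟩
  n ∸ 1                 ∎)
  where open ≡-Reasoning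

oneToZero-≢l1 : ∀ {x} → x ≢ l1 → oneToZero x ≡ x
oneToZero-≢l1 {l0} _   = refl
oneToZero-≢l1 {l1} ≢l1 = contradiction refl ≢l1
oneToZero-≢l1 {l2} _   = refl

oneToZero-≤ : ∀ x → val (oneToZero x) ≤ val x
oneToZero-≤ l0 = z≤n
oneToZero-≤ l1 = z≤n
oneToZero-≤ l2 = ≤-refl

oneToZero≡l2 : ∀ {x} → oneToZero x ≡ l2 → x ≡ l2
oneToZero≡l2 {l2} _ = refl

oneToZero≢l1 : ∀ x → oneToZero x ≢ l1
oneToZero≢l1 l0 ()
oneToZero≢l1 l1 ()
oneToZero≢l1 l2 ()

ones-map-oneToZero : ∀ {n} (w : Word n) → ones (map oneToZero w) ≡ 0
ones-map-oneToZero []       = refl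
ones-map-oneToZero (l0 ∷ w) = ones-map-oneToZero w
ones-map-oneToZero (l1 ∷ w) = ones-map-oneToZero w
ones-map-oneToZero (l2 ∷ w) = ones-map-oneToZero w

eraseEntryIfOne : Letter → Content → Content
eraseEntryIfOne l1 _ = empty
eraseEntryIfOne _  c = c

lookup-eraseIfOne : ∀ {n} x (row : Vec Content n) j → lookup (eraseIfOne x row) j ≡ eraseEntryIfOne x (lookup row j)
lookup-eraseIfOne l0 row j = refl
lookup-eraseIfOne l1 row j = lookup-map j _ row
lookup-eraseIfOne l2 row j = refl

eraseIfOne-≢l1 : ∀ {n} {x} (row : Vec Content n) → x ≢ l1 → eraseIfOne x row ≡ row
eraseIfOne-≢l1 {x = l0} row _   = refl
eraseIfOne-≢l1 {x = l1} row ≢l1 = contradiction refl ≢l1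
eraseIfOne-≢l1 {x = l2} row _   = refl

eraseEntryIfOne-arrow : ∀ x {c a} → eraseEntryIfOne x c ≡ a → a ≢ empty → x ≢ l1 × c ≡ a
eraseEntryIfOne-arrow l0 c≡a _       = (λ ()) , c≡a
eraseEntryIfOne-arrow l1 empty≡a a≢empty = contradiction (sym empty≡a) a≢empty
eraseEntryIfOne-arrow l2 c≡a _       = (λ ()) , c≡a

eraseEntryIfOne-empty : ∀ x → eraseEntryIfOne x empty ≡ empty
eraseEntryIfOne-empty l0 = refl
eraseEntryIfOne-empty l1 = refl
eraseEntryIfOne-empty l2 = refl

module Str {n} (w : Word n) (F : Filling n) where

  w′ : Word n
  w′ = proj₁ (str (w , F))

  F′ : Filling n
  F′ = proj₂ (str (w , F))

  letter-str : ∀ i → lookup w′ i ≡ oneToZero (lookup w i)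
  letter-str i = lookup-map i oneToZero w

  entry-str : ∀ i j → entry F′ i j ≡ eraseEntryIfOne (lookup w i) (entry F i j)
  entry-str i j = trans (cong (λ row → lookup row j) (lookup-zipWith eraseIfOne i w F)) (lookup-eraseIfOne (lookup w i) (lookup F i) j)

  arrow-str : ∀ {i j a} → entry F′ i j ≡ a → a ≢ empty → lookup w i ≢ l1 × entry F i j ≡ a
  arrow-str {i} {j} e = eraseEntryIfOne-arrow (lookup w i) (trans (sym (entry-str i j)) e)

  row-str-kept : ∀ {i} → lookup w i ≢ l1 → lookup F′ i ≡ lookup F i
  row-str-kept {i} wi≢l1 = trans (lookup-zipWith eraseIfOne i w F) (eraseIfOne-≢l1 (lookup F i) wi≢l1)

  entry-str-kept : ∀ {i j} → lookup w i ≢ l1 → entry F′ i j ≡ entry F i j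
  entry-str-kept {j = j} wi≢l1 = cong (λ row → lookup row j) (row-str-kept wi≢l1)

  empty-str : ∀ {i j} → entry F i j ≡ empty → entry F′ i j ≡ empty
  empty-str {i} {j} e = trans (entry-str i j) (trans (cong (eraseEntryIfOne (lookup w i)) e) (eraseEntryIfOne-empty (lookup w i)))

  cell-str : ∀ {i j} → lookup w i ≢ l1 → IsCell w i j → IsCell w′ i j
  cell-str {i} {j} wi≢l1 (i<j , wj<wi) =
    isCell w′ i<j (trans (letter-str i) (oneToZero-≢l1 wi≢l1)) (letter-str j) (≤-<-trans (oneToZero-≤ (lookup w j)) wj<wi)

  northOf-str : ∀ {i i′} → lookup w i ≡ l2 → NorthOf w′ i′ i → NorthOf w i′ i
  northOf-str {i} {i′} wi≡l2 (inj₁ (same , i′<i)) = inj₁ (trans wi′≡l2 (sym wi≡l2) , i′<i)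
    where
    wi′≡l2 : lookup w i′ ≡ l2
    wi′≡l2 = oneToZero≡l2 (trans (sym (letter-str i′)) (trans same (trans (letter-str i) (cong oneToZero wi≡l2))))
  northOf-str {i′ = i′} _ (inj₂ (w′i′≡l1 , _)) =
    contradiction (trans (sym (letter-str i′)) w′i′≡l1) (oneToZero≢l1 (lookup w i′))

  str-isRAT : IsRAT (w , F) → IsRAT (str (w , F))
  str-isRAT rat = up-in-column′ , left-in-row′ , pointed-empty′
    where
    open RAT w F rat
    up-in-column′ : ∀ i j → entry F′ i j ≡ up → IsCell w′ i j × lookup w′ j ≡ l0
    up-in-column′ i j e with arrow-str e up≢empty
    ... | wi≢l1 , e′ =
      cell-str wi≢l1 (proj₁ (up-in-column e′)) , trans (letter-str j) (cong oneToZero (proj₂ (up-in-column e′)))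
    left-in-row′ : ∀ i j → entry F′ i j ≡ left → IsCell w′ i j × lookup w′ i ≡ l2
    left-in-row′ i j e with arrow-str e left≢empty
    ... | wi≢l1 , e′ =
      cell-str wi≢l1 (proj₁ (left-in-row e′)) , trans (letter-str i) (cong oneToZero (proj₂ (left-in-row e′)))
    pointed-empty′ : ∀ i j i′ j′ → PointsTo (str (w , F)) i j i′ j′ → entry F′ i′ j′ ≡ empty
    pointed-empty′ i j _ j′ (inj₁ (e , refl , j<j′)) with arrow-str e left≢empty
    ... | _ , e′ = empty-str (pointed-empty (inj₁ (e′ , refl , j<j′)))
    pointed-empty′ i j i′ _ (inj₂ (e , refl , north)) with arrow-str e up≢empty
    ... | wi≢l1 , e′ = empty-str (pointed-empty (inj₂ (e′ , refl , northOf-str (up-row e′ wi≢l1) north)))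

  str-noFreeRows : NoFreeRows (w , F) → NoFreeRows (str (w , F))
  str-noFreeRows noFreeRows i w′i≡l2 = Product.map₂ (trans (entry-str-kept wi≢l1)) (noFreeRows i wi≡l2)
    where
    wi≡l2 : lookup w i ≡ l2
    wi≡l2 = oneToZero≡l2 (trans (sym (letter-str i)) w′i≡l2)
    wi≢l1 : lookup w i ≢ l1
    wi≢l1 wi≡l1 = contradiction (trans (sym wi≡l2) wi≡l1) λ ()

FreeColumn : ∀ {n} → Tab n → Fin n → Set
FreeColumn (w , F) j = lookup w j ≡ l0 × (∀ i → entry F i j ≢ up)

freeColumn? : ∀ {n} (S : Tab n) → Decidable (FreeColumn S)
freeColumn? (w , F) j = l0? (lookup w j) ×-dec all? (λ i → ¬? (up? (entry F i j)))

nonFreeColumn⇒up : ∀ {n} (w : Word n) (F : Filling n) {j} →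
                   lookup w j ≡ l0 → ¬ FreeColumn (w , F) j → ∃ λ i → entry F i j ≡ up
nonFreeColumn⇒up {n} w F {j} wj≡l0 nonFree =
  Product.map₂ (decidable-stable (up? _)) (¬∀⟶∃¬ n _ (λ i → ¬? (up? (entry F i j))) (λ noUp → nonFree (wj≡l0 , noUp)))

freeColumn-exists : ∀ {n} (w : Word n) (F : Filling n) → 1 ≤ n → IsRAT (w , F) → (∀ i → lookup w i ≢ l1) →
                    NoFreeRows (w , F) → ∃ (FreeColumn (w , F))
freeColumn-exists {suc m} w F _ rat noOne noFreeRows with lookup w zero in w₀≡
... | l0 = zero , w₀≡ , λ i e → n≮0 (proj₁ (proj₁ (RAT.up-in-column w F rat e)))
... | l1 = contradiction w₀≡ (noOne zero)
... | l2 with noFreeRows zero w₀≡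
...   | j , e = j , wj≡l0 , noUp
  where
  open RAT w F rat
  wj≡l0 : lookup w j ≡ l0
  wj≡l0 = <l2,≢l1⇒≡l0 (subst (λ x → val (lookup w j) < val x) w₀≡ (proj₂ (proj₁ (left-in-row e)))) (noOne j)
  noUp : ∀ i → entry F i j ≢ up
  noUp zero    e′ = contradiction (trans (sym e) e′) λ ()
  noUp (suc i) e′ = contradiction (trans (sym e) (pointed-empty (inj₂ (e′ , refl , row₀-north)))) left≢empty
    where
    row₀-north : NorthOf w zero (suc i)
    row₀-north = inj₁ (trans w₀≡ (sym (up-row e′ (noOne (suc i)))) , z<s)

upIf : ∀ {P : Set} → Dec P → Content
upIf (yes _) = up
upIf (no _)  = empty

upIf-yes : ∀ {P : Set} (P? : Dec P) → P → upIf P? ≡ up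
upIf-yes (yes _) _ = refl
upIf-yes (no ¬p) p = contradiction p ¬p

upIf-no : ∀ {P : Set} (P? : Dec P) → ¬ P → upIf P? ≡ empty
upIf-no (yes p) ¬p = contradiction p ¬p
upIf-no (no _)  _  = refl

upIf≡up : ∀ {P : Set} (P? : Dec P) → upIf P? ≡ up → P
upIf≡up (yes p) _ = p

upIf≢left : ∀ {P : Set} (P? : Dec P) → upIf P? ≢ left
upIf≢left (yes _) ()
upIf≢left (no _)  ()

diagonalEntry : ∀ {n} → Tab n → Fin n → Fin n → Content
diagonalEntry S d j = upIf (d <? j ×-dec freeColumn? S j)

unstr : ∀ {n} → Tab n → Fin n → Tab n
unstr (w , F) d = w [ d ]≔ l1 , F [ d ]≔ tabulate (diagonalEntry (w , F) d)

module Recover {n} (w : Word n) (F : Filling n) (rat : IsRAT (w , F)) (noFreeColumns : NoFreeColumns (w , F))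
               {d} (oneAt : UniqueOneAt w d) where
  open RAT w F rat
  open Str w F

  wd≡l1 : lookup w d ≡ l1
  wd≡l1 = proj₁ oneAt

  ≢d⇒≢l1 : ∀ {i} → i ≢ d → lookup w i ≢ l1
  ≢d⇒≢l1 i≢d wi≡l1 = i≢d (proj₂ oneAt _ wi≡l1)

  letter-str-≢d : ∀ {i} → i ≢ d → lookup w′ i ≡ lookup w i
  letter-str-≢d i≢d = trans (letter-str _) (oneToZero-≢l1 (≢d⇒≢l1 i≢d))

  up-str : ∀ {i j} → i ≢ d → entry F i j ≡ up → entry F′ i j ≡ up
  up-str i≢d e = trans (entry-str-kept (≢d⇒≢l1 i≢d)) e

  str-leastFreeColumn : Least (FreeColumn (str (w , F))) d
  str-leastFreeColumn = (trans (letter-str d) (cong oneToZero wd≡l1) , noUp) , westNotFree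
    where
    noUp : ∀ i → entry F′ i d ≢ up
    noUp i e = contradiction (trans (sym wd≡l1) (proj₂ (up-in-column (proj₂ (arrow-str e up≢empty))))) λ ()
    westNotFree : ∀ j → j Fin.< d → ¬ FreeColumn (str (w , F)) j
    westNotFree j j<d (w′j≡l0 , noUp′) with noFreeColumns j (trans (sym (letter-str-≢d (<⇒≢ j<d))) w′j≡l0)
    ... | i , e = noUp′ i (up-str (<⇒≢ (<-trans (proj₁ (proj₁ (up-in-column e))) j<d)) e)

  diagonal-entry : ∀ j → entry F d j ≡ diagonalEntry (str (w , F)) d j
  diagonal-entry j with entry F d j in e
  ... | left  = contradiction (trans (sym wd≡l1) (proj₂ (left-in-row e))) λ ()
  ... | up    = sym (upIf-yes _ (d<j , trans (letter-str-≢d (<⇒≢ d<j ∘ sym)) (proj₂ (up-in-column e)) , onlyUp))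
    where
    d<j : d Fin.< j
    d<j = proj₁ (proj₁ (up-in-column e))
    onlyUp : ∀ i → entry F′ i j ≢ up
    onlyUp i e′ with arrow-str e′ up≢empty
    ... | wi≢l1 , e″ = wi≢l1 (subst (λ k → lookup w k ≡ l1) (up-unique e e″) wd≡l1)
  ... | empty = sym (upIf-no _ notFree)
    where
    notFree : ¬ (d Fin.< j × FreeColumn (str (w , F)) j)
    notFree (d<j , w′j≡l0 , noUp) with noFreeColumns j (trans (sym (letter-str-≢d (<⇒≢ d<j ∘ sym))) w′j≡l0)
    ... | i , e′ with i ≟ d
    ...   | yes refl = contradiction (trans (sym e) e′) λ ()
    ...   | no i≢d   = noUp i (up-str i≢d e′)

  unstr-str : unstr (str (w , F)) d ≡ (w , F)
  unstr-str = cong₂ _,_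
    (update-≡ (sym wd≡l1) (λ _ → letter-str-≢d))
    (update-≡ (lookup-extensionality λ j → trans (lookup∘tabulate _ j) (sym (diagonal-entry j)))
              (λ _ → row-str-kept ∘ ≢d⇒≢l1))

module Unstr {n} (w : Word n) (F : Filling n) (rat : IsRAT (w , F)) (noOne : ∀ i → lookup w i ≢ l1)
             {d} (free : FreeColumn (w , F) d) where
  open RAT w F rat

  wᵈ : Word n
  wᵈ = proj₁ (unstr (w , F) d)

  Fᵈ : Filling n
  Fᵈ = proj₂ (unstr (w , F) d)

  letter-d : lookup wᵈ d ≡ l1
  letter-d = lookup∘update d w l1

  letter-≢d : ∀ {i} → i ≢ d → lookup wᵈ i ≡ lookup w i
  letter-≢d i≢d = lookup∘update′ i≢d w l1

  row-≢d : ∀ {i} → i ≢ d → lookup Fᵈ i ≡ lookup F i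
  row-≢d i≢d = lookup∘update′ i≢d F _

  entry-d : ∀ j → entry Fᵈ d j ≡ diagonalEntry (w , F) d j
  entry-d j = trans (cong (λ row → lookup row j) (lookup∘update d F _)) (lookup∘tabulate _ j)

  entry-≢d : ∀ {i j} → i ≢ d → entry Fᵈ i j ≡ entry F i j
  entry-≢d {j = j} i≢d = cong (λ row → lookup row j) (row-≢d i≢d)

  ≢l1⇒≢d : ∀ {i x} → lookup wᵈ i ≡ x → x ≢ l1 → i ≢ d
  ≢l1⇒≢d wᵈi≡x x≢l1 refl = x≢l1 (trans (sym wᵈi≡x) letter-d)

  oneAt : UniqueOneAt wᵈ d
  oneAt = letter-d , unique
    where
    unique : ∀ i → lookup wᵈ i ≡ l1 → i ≡ d
    unique i wᵈi≡l1 with i ≟ d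
    ... | yes i≡d = i≡d
    ... | no i≢d  = contradiction (trans (sym (letter-≢d i≢d)) wᵈi≡l1) (noOne i)

  cell-≢d : ∀ {i j} → i ≢ d → j ≢ d → IsCell w i j → IsCell wᵈ i j
  cell-≢d i≢d j≢d (i<j , wj<wi) = isCell wᵈ i<j (letter-≢d i≢d) (letter-≢d j≢d) wj<wi

  up-column≢d : ∀ {i j} → entry F i j ≡ up → j ≢ d
  up-column≢d {i} e refl = proj₂ free i e

  unstr-isRAT : IsRAT (unstr (w , F) d)
  unstr-isRAT = up-in-columnᵈ , left-in-rowᵈ , pointed-emptyᵈ
    where
    up-in-columnᵈ : ∀ i j → entry Fᵈ i j ≡ up → IsCell wᵈ i j × lookup wᵈ j ≡ l0
    up-in-columnᵈ i j e with i ≟ d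
    ... | yes refl with upIf≡up _ (trans (sym (entry-d j)) e)
    ...   | d<j , wj≡l0 , _ = isCell wᵈ d<j letter-d wᵈj≡l0 z<s , wᵈj≡l0
      where
      wᵈj≡l0 : lookup wᵈ j ≡ l0
      wᵈj≡l0 = trans (letter-≢d (<⇒≢ d<j ∘ sym)) wj≡l0
    up-in-columnᵈ i j e | no i≢d = cell-≢d i≢d (up-column≢d e′) (proj₁ (up-in-column e′)) ,
                                   trans (letter-≢d (up-column≢d e′)) (proj₂ (up-in-column e′))
      where
      e′ : entry F i j ≡ up
      e′ = trans (sym (entry-≢d i≢d)) e
    left-in-rowᵈ : ∀ i j → entry Fᵈ i j ≡ left → IsCell wᵈ i j × lookup wᵈ i ≡ l2
    left-in-rowᵈ i j e with i ≟ d
    ... | yes refl = contradiction (trans (sym (entry-d j)) e) (upIf≢left _)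
    ... | no i≢d   = cell , wᵈi≡l2
      where
      e′ : entry F i j ≡ left
      e′ = trans (sym (entry-≢d i≢d)) e
      wᵈi≡l2 : lookup wᵈ i ≡ l2
      wᵈi≡l2 = trans (letter-≢d i≢d) (proj₂ (left-in-row e′))
      cell : IsCell wᵈ i j
      cell with j ≟ d
      ... | yes refl = isCell wᵈ (proj₁ (proj₁ (left-in-row e′))) wᵈi≡l2 letter-d (s≤s z<s)
      ... | no j≢d   = cell-≢d i≢d j≢d (proj₁ (left-in-row e′))
    pointed-emptyᵈ : ∀ i j i′ j′ → PointsTo (unstr (w , F) d) i j i′ j′ → entry Fᵈ i′ j′ ≡ empty
    pointed-emptyᵈ i j _ j′ (inj₁ (e , refl , j<j′)) with i ≟ d
    ... | yes refl = contradiction (trans (sym (entry-d j)) e) (upIf≢left _)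
    ... | no i≢d   = trans (entry-≢d i≢d) (pointed-empty (inj₁ (trans (sym (entry-≢d i≢d)) e , refl , j<j′)))
    pointed-emptyᵈ i j i′ _ (inj₂ (e , refl , north)) with i ≟ d
    ... | yes refl = contradiction north noneNorthOfD
      where
      noneNorthOfD : ¬ NorthOf wᵈ i′ d
      noneNorthOfD (inj₁ (same , i′<d)) = <⇒≢ i′<d (proj₂ oneAt _ (trans same letter-d))
      noneNorthOfD (inj₂ (_ , wᵈd≡l2)) = contradiction (trans (sym letter-d) wᵈd≡l2) λ ()
    ... | no i≢d with i′ ≟ d
    ...   | yes refl = trans (entry-d j) (upIf-no _ λ (_ , _ , noUp) → noUp i (trans (sym (entry-≢d i≢d)) e))
    ...   | no i′≢d  = trans (entry-≢d i′≢d) (pointed-empty (inj₂ (trans (sym (entry-≢d i≢d)) e , refl , north′)))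
      where
      north′ : NorthOf w i′ i
      north′ = northOf-cong wᵈ w (letter-≢d i≢d) (letter-≢d i′≢d) north

  unstr-noFreeRows : NoFreeRows (w , F) → NoFreeRows (unstr (w , F) d)
  unstr-noFreeRows noFreeRows i wᵈi≡l2 =
    Product.map₂ (trans (entry-≢d i≢d)) (noFreeRows i (trans (sym (letter-≢d i≢d)) wᵈi≡l2))
    where
    i≢d : i ≢ d
    i≢d = ≢l1⇒≢d wᵈi≡l2 λ ()

  unstr-noFreeColumns : (∀ j → j Fin.< d → ¬ FreeColumn (w , F) j) → NoFreeColumns (unstr (w , F) d)
  unstr-noFreeColumns westNotFree j wᵈj≡l0 with freeColumn? (w , F) j | <-cmp j d
  ... | yes freeʲ  | tri< j<d _ _ = contradiction freeʲ (westNotFree j j<d)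
  ... | yes _      | tri≈ _ j≡d _ = contradiction j≡d (≢l1⇒≢d wᵈj≡l0 λ ())
  ... | yes freeʲ  | tri> _ _ d<j = d , trans (entry-d j) (upIf-yes _ (d<j , freeʲ))
  ... | no nonFree | _ with nonFreeColumn⇒up w F (trans (sym (letter-≢d (≢l1⇒≢d wᵈj≡l0 λ ()))) wᵈj≡l0) nonFree
  ...   | i , e = i , trans (entry-≢d i≢d) e
    where
    i≢d : i ≢ d
    i≢d refl = contradiction (trans (sym e) (l0-row-empty (proj₁ free))) up≢empty

  str-unstr : str (unstr (w , F) d) ≡ (w , F)
  str-unstr = cong₂ _,_ (lookup-extensionality letter) (lookup-extensionality row)
    where
    letter : ∀ i → lookup (map oneToZero wᵈ) i ≡ lookup w i
    letter i with i ≟ d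
    ... | yes refl = trans (lookup-map d oneToZero wᵈ) (trans (cong oneToZero letter-d) (sym (proj₁ free)))
    ... | no i≢d   = trans (lookup-map i oneToZero wᵈ) (trans (cong oneToZero (letter-≢d i≢d)) (oneToZero-≢l1 (noOne i)))
    row : ∀ i → lookup (zipWith eraseIfOne wᵈ Fᵈ) i ≡ lookup F i
    row i with i ≟ d
    ... | yes refl = trans (lookup-zipWith eraseIfOne d wᵈ Fᵈ) (trans (cong (λ x → eraseIfOne x (lookup Fᵈ d)) letter-d)
                       (lookup-extensionality λ j → trans (lookup-map j _ (lookup Fᵈ d)) (sym (l0-row-empty (proj₁ free)))))
    ... | no i≢d   = trans (lookup-zipWith eraseIfOne i wᵈ Fᵈ) (trans (cong₂ eraseIfOne (letter-≢d i≢d) (row-≢d i≢d))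
                       (eraseIfOne-≢l1 (lookup F i) (noOne i)))

str-alternative-noFreeRows : ∀ {n} (T : Tab n) → 1 ≤ n → IsPackedDiag n T → IsAltTableau n (str T) × NoFreeRows (str T)
str-alternative-noFreeRows (w , F) 1≤n packed =
  (Str.str-isRAT w F (proj₁ (proj₁ packed)) , ones-map-oneToZero w) ,
  Str.str-noFreeRows w F (proj₁ (packed⇒noFreeLines (w , F) 1≤n packed))

unstr∘str : ∀ {n} (T : Tab n) → 1 ≤ n → IsPackedDiag n T → ∃ λ d → Least (FreeColumn (str T)) d × unstr (str T) d ≡ T
unstr∘str (w , F) 1≤n packed with ones≡1⇒uniqueOne w (proj₂ (proj₁ packed))
... | d , oneAt = d , str-leastFreeColumn , unstr-str
  where open Recover w F (proj₁ (proj₁ packed)) (proj₂ (packed⇒noFreeLines (w , F) 1≤n packed)) oneAt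

str-injective : ∀ {n} (T T′ : Tab n) → 1 ≤ n → IsPackedDiag n T → IsPackedDiag n T′ → str T ≡ str T′ → T ≡ T′
str-injective T T′ 1≤n packed packed′ strT≡strT′ with unstr∘str T 1≤n packed | unstr∘str T′ 1≤n packed′
... | d , least , T≡ | d′ , least′ , T′≡ = begin
  T                   ≡⟨ T≡ ⟨
  unstr (str T) d     ≡⟨ cong₂ unstr strT≡strT′ (least-unique {P = FreeColumn (str T′)} least″ least′) ⟩
  unstr (str T′) d′   ≡⟨ T′≡ ⟩
  T′                  ∎
  where
  open ≡-Reasoning
  least″ : Least (FreeColumn (str T′)) d
  least″ = subst (λ S → Least (FreeColumn S) d) strT≡strT′ least

str-surjective : ∀ {n} (S : Tab n) → 1 ≤ n → IsAltTableau n S → NoFreeRows S → ∃ λ T → IsPackedDiag n T × str T ≡ S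
str-surjective {n} (w , F) 1≤n (rat , ones≡0) noFreeRows
  with ∃-least (freeColumn? (w , F)) (freeColumn-exists w F 1≤n rat (ones≡0⇒noOne w ones≡0) noFreeRows)
... | d , free , westNotFree = unstr (w , F) d , packed , str-unstr
  where
  open Unstr w F rat (ones≡0⇒noOne w ones≡0) free
  packed : IsPackedDiag n (unstr (w , F) d)
  packed = noFreeLines⇒packed (unstr (w , F) d) unstr-isRAT (uniqueOne⇒ones≡1 wᵈ oneAt)
                              (unstr-noFreeRows noFreeRows) (unstr-noFreeColumns westNotFree)

lemma3p3 : (n : ℕ) → 1 ≤ n →
    ((T : Tab n) → IsPackedDiag n T → IsAltTableau n (str T) × NoFreeRows (str T))
    × ((T T′ : Tab n) → IsPackedDiag n T → IsPackedDiag n T′ → str T ≡ str T′ → T ≡ T′)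
    × ((S : Tab n) → IsAltTableau n S → NoFreeRows S → ∃ λ T → IsPackedDiag n T × str T ≡ S)
lemma3p3 n 1≤n =
  (λ T → str-alternative-noFreeRows T 1≤n) , (λ T T′ → str-injective T T′ 1≤n) , (λ S → str-surjective S 1≤n)
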